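{- Let $H$ be a bipartite graph. (1) There exists a family $\mathcal{B}$ of subgraphs that $\dim(H)$-covers $H^c$. (2) If $H^c$ can be $r$-covered, then $\dim(H)\le r^2+2$.
   Context: Graphs are finite, simple and loopless. For a bipartite graph $F$ with bipartition classes $X,Y$, its bipartite complement $F^c$ is the bipartite graph with classes $X,Y$ in which $uv\in X\times Y$ is an edge iff $uv\notin E(F)$. A family $\mathcal{B}=\{B_1,\dots,B_s\}$ of subgraphs of a bipartite graph $F$ $r$-covers $F$ if each $B_i$ is a biclique (complete bipartite graph), $\bigcup_i E(B_i)=E(F)$, and every vertex of $F$ lies in at most $r$ members of $\mathcal{B}$; $F$ can be $r$-covered if such a family exists. The Prague dimension $\dim(H)$ is the least integer $p$ such that there exist integers $n_1,\dots,n_p$ for which $H$ is isomorphic to an induced subgraph of the direct product $K_{n_1}\times\cdots\times K_{n_p}$ of complete graphs; equivalently, the vertices of $H$ can be encoded by distinct sequences of length $p$ such that two vertices are adjacent iff their sequences differ in every coordinate. (The direct product $H_1\times H_2$ has vertex set $V(H_1)\times V(H_2)$ with $(v_1,v_2)(u_1,u_2)$ an edge iff $v_1u_1\in E(H_1)$ and $v_2u_2\in E(H_2)$.) -}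

module Defs where

open import Data.Nat using (ℕ; _≤_; _+_; _*_)
open import Data.Bool using (Bool; true; false; not)
open import Data.Fin using (Fin)
open import Data.Fin.Subset using (Subset; _∈_; ∣_∣)
open import Data.Vec using (tabulate; lookup)
open import Data.Sum using (_⊎_; inj₁; inj₂)
open import Data.Product using (Σ; ∃; _×_)
open import Data.Empty using (⊥)
open import Relation.Binary.PropositionalEquality using (_≡_; _≢_)
open import Function.Bundles using (_⇔_)
open import Function.Definitions using (Injective)

record BipGraph : Set where
  field
    m n : ℕ
    edge : Fin m → Fin n → Bool
open BipGraph public

bipComplement : BipGraph → BipGraph
bipComplement F = record { m = m F ; n = n F ; edge = λ x y → not (edge F x y) }

Vertex : BipGraph → Set
Vertex F = Fin (m F) ⊎ Fin (n F)

Adj : (F : BipGraph) → Vertex F → Vertex F → Set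
Adj F (inj₁ x) (inj₂ y) = edge F x y ≡ true
Adj F (inj₂ y) (inj₁ x) = edge F x y ≡ true
Adj F (inj₁ _) (inj₁ _) = ⊥
Adj F (inj₂ _) (inj₂ _) = ⊥

-- H is an induced subgraph of K_{n_1} × ... × K_{n_p}: distinct sequences of
-- length p (entries in ℕ; any finite encoding uses finitely many values, which
-- play the role of n_1,…,n_p), distinct vertices adjacent iff their sequences
-- differ in every coordinate.
PragueRep : BipGraph → ℕ → Set
PragueRep H p =
  Σ (Vertex H → Fin p → ℕ) λ f →
    Injective _≡_ _≡_ f ×
    (∀ u v → u ≢ v → (Adj H u v ⇔ (∀ i → f u i ≢ f v i)))

IsPragueDim : BipGraph → ℕ → Set
IsPragueDim H d = PragueRep H d × (∀ q → PragueRep H q → d ≤ q)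

record Biclique (F : BipGraph) : Set where
  field
    left  : Subset (m F)
    right : Subset (n F)
    sub   : ∀ x y → x ∈ left → y ∈ right → edge F x y ≡ true
open Biclique public

RCovers : (F : BipGraph) (r s : ℕ) → (Fin s → Biclique F) → Set
RCovers F r s B =
  (∀ x y → edge F x y ≡ true → ∃ λ i → x ∈ left (B i) × y ∈ right (B i)) ×
  (∀ x → ∣ tabulate (λ i → lookup (left (B i)) x) ∣ ≤ r) ×
  (∀ y → ∣ tabulate (λ i → lookup (right (B i)) y) ∣ ≤ r)

CanBeCovered : BipGraph → ℕ → Set
CanBeCovered F r = Σ ℕ λ s → Σ (Fin s → Biclique F) λ B → RCovers F r s B

{-# OPTIONS --safe #-}
module Submission where

-- A Prague representation of H in d coordinates says, between the two sides,
-- that x and y are non-adjacent iff they agree in some coordinate.  Hence Hᶜ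
-- is the union of d graphs, the i-th of which is the disjoint union of the
-- bicliques "value v in coordinate i"; splitting every coordinate into its
-- value classes is a cover of Hᶜ using one biclique per vertex and coordinate.
-- Conversely, given an r-cover, list the at most r bicliques at each vertex;
-- coordinate (a , b) compares the a-th biclique at x with the b-th biclique at
-- y, and two further coordinates separate all vertices while making vertices
-- on the same side agree somewhere.

open import Defs
open import Data.Bool using (Bool; true; false; not)
open import Data.Empty using (⊥-elim)
open import Data.Fin using (Fin; zero; suc; toℕ; _<_; punchOut; remQuot; combine; _↑ˡ_; _↑ʳ_; splitAt)
open import Data.Fin.Properties
  using (suc-injective; punchOut-injective; toℕ-injective; <-cmp; _<?_; all?; ¬∀⟶∃¬;
         remQuot-combine; combine-remQuot)
open import Data.Fin.Subset using (_∈_; ∣_∣)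
open import Data.Maybe using (Maybe; just; nothing)
import Data.Maybe as Maybe
open import Data.Nat using (ℕ; _≤_; _+_; _*_; z≤n; s≤s; s≤s⁻¹)
import Data.Nat.Properties as ℕ
import Data.Product as Σ
open import Data.Product using (∃; _×_; _,_; proj₁; proj₂; uncurry)
open import Data.Sum using (inj₁; inj₂)
open import Data.Vec using (tabulate; lookup)
open import Data.Vec.Properties using (lookup∘tabulate; tabulate-cong; []=⇒lookup; lookup⇒[]=)
open import Data.Vec.Functional using (Vector; _++_; _∷_; [])
open import Data.Vec.Functional.Properties using (lookup-++ˡ; lookup-++ʳ; ++-injectiveʳ)
open import Function using (_∘_)
open import Function.Bundles using (_⇔_; mk⇔; Equivalence)
open import Function.Definitions using (Injective)
open import Relation.Binary using (DecidableEquality; tri<; tri≈; tri>)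
open import Relation.Binary.PropositionalEquality
open import Relation.Nullary using (¬_; Dec; yes; no; does; ¬?; _→-dec_; _×-dec_)
open import Relation.Nullary.Decidable using (dec-true; decidable-stable)
open import Relation.Unary using (Pred; Decidable)

open Equivalence using (to; from)

not≡true⇔≢true : ∀ {b} → not b ≡ true ⇔ b ≢ true
not≡true⇔≢true {false} = mk⇔ (λ _ ()) (λ _ → refl)
not≡true⇔≢true {true}  = mk⇔ (λ ()) (λ true≢true → ⊥-elim (true≢true refl))

does≡true⇒ : ∀ {p} {P : Set p} (P? : Dec P) → does P? ≡ true → P
does≡true⇒ (yes p) _  = p
does≡true⇒ (no _)  ()

∈-tabulate-does⇔ : ∀ {n p} {P : Pred (Fin n) p} (P? : Decidable P) {x} →
                   x ∈ tabulate (does ∘ P?) ⇔ P x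
∈-tabulate-does⇔ P? {x} = mk⇔
  (λ x∈ → does≡true⇒ (P? x) (trans (sym (lookup∘tabulate (does ∘ P?) x)) ([]=⇒lookup x∈)))
  (λ px → lookup⇒[]= x _ (trans (lookup∘tabulate (does ∘ P?) x) (dec-true (P? x) px)))

∣tabulate-lookup-tabulate∣ : ∀ {s t} (g : Fin s → Fin t → Bool) x →
                             ∣ tabulate (λ k → lookup (tabulate (g k)) x) ∣ ≡ ∣ tabulate (λ k → g k x) ∣
∣tabulate-lookup-tabulate∣ g x = cong ∣_∣ (tabulate-cong (λ k → lookup∘tabulate (g k) x))

remQuot-injective : ∀ {m} n {k k′ : Fin (m * n)} → remQuot {m} n k ≡ remQuot n k′ → k ≡ k′
remQuot-injective {m} n {k} {k′} eq = begin
  k                                  ≡⟨ combine-remQuot {m} n k ⟨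
  uncurry combine (remQuot {m} n k)  ≡⟨ cong (uncurry combine) eq ⟩
  uncurry combine (remQuot {m} n k′) ≡⟨ combine-remQuot {m} n k′ ⟩
  k′                                 ∎
  where open ≡-Reasoning

injection⇒∣tabulate∣≤ : ∀ {s d} (g : Fin s → Bool) (c : ∀ i → g i ≡ true → Fin d) →
                        (∀ {i j} p q → c i p ≡ c j q → i ≡ j) → ∣ tabulate g ∣ ≤ d
injection⇒∣tabulate∣≤ {ℕ.zero} g c c-injective = z≤n
injection⇒∣tabulate∣≤ {ℕ.suc s} g c c-injective with g zero in g₀
... | false = injection⇒∣tabulate∣≤ (g ∘ suc) (c ∘ suc) (λ p q → suc-injective ∘ c-injective p q)
injection⇒∣tabulate∣≤ {ℕ.suc s} {ℕ.zero} g c c-injective | true with () ← c zero g₀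
injection⇒∣tabulate∣≤ {ℕ.suc s} {ℕ.suc d} g c c-injective | true =
  s≤s (injection⇒∣tabulate∣≤ (g ∘ suc) c′ c′-injective)
  where
  c₀≢c : ∀ i p → c zero g₀ ≢ c (suc i) p
  c₀≢c i p eq with () ← c-injective g₀ p eq

  c′ : ∀ i → g (suc i) ≡ true → Fin d
  c′ i p = punchOut (c₀≢c i p)

  c′-injective : ∀ {i j} p q → c′ i p ≡ c′ j q → i ≡ j
  c′-injective p q eq = suc-injective (c-injective p q (punchOut-injective (c₀≢c _ p) (c₀≢c _ q) eq))

Enumerates : ∀ {s r} → (Fin s → Bool) → (Fin r → Maybe (Fin s)) → Set
Enumerates g e = (∀ a {j} → e a ≡ just j → g j ≡ true)
               × (∀ j → g j ≡ true → ∃ λ a → e a ≡ just j)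

shifted-sound : ∀ {s r} {g : Fin (ℕ.suc s) → Bool} {e : Fin r → Maybe (Fin s)} →
                (∀ a {j} → e a ≡ just j → g (suc j) ≡ true) →
                ∀ a {j} → Maybe.map suc (e a) ≡ just j → g j ≡ true
shifted-sound {e = e} sound a eq with e a in ea
shifted-sound sound a refl | just j  = sound a ea
shifted-sound sound a ()   | nothing

shifted-complete : ∀ {s r} {g : Fin (ℕ.suc s) → Bool} {e : Fin r → Maybe (Fin s)} →
                   (∀ j → g (suc j) ≡ true → ∃ λ a → e a ≡ just j) →
                   ∀ j → g (suc j) ≡ true → ∃ λ a → Maybe.map suc (e a) ≡ just (suc j)
shifted-complete complete j gj≡true = let a , ea≡j = complete j gj≡true in a , cong (Maybe.map suc) ea≡j

enumerates-skip : ∀ {s r} {g : Fin (ℕ.suc s) → Bool} {e : Fin r → Maybe (Fin s)} →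
                  Enumerates (g ∘ suc) e → g zero ≡ false → Enumerates g (Maybe.map suc ∘ e)
enumerates-skip {g = g} {e} (sound , complete) g₀≡false = shifted-sound {g = g} sound , complete′
  where
  complete′ : ∀ j → g j ≡ true → ∃ λ a → Maybe.map suc (e a) ≡ just j
  complete′ zero    g₀≡true with () ← trans (sym g₀≡false) g₀≡true
  complete′ (suc j) = shifted-complete {g = g} complete j

enumerates-cons : ∀ {s r} {g : Fin (ℕ.suc s) → Bool} {e : Fin r → Maybe (Fin s)} →
                  Enumerates (g ∘ suc) e → g zero ≡ true → Enumerates g (just zero ∷ Maybe.map suc ∘ e)
enumerates-cons {g = g} {e} (sound , complete) g₀≡true = sound′ , complete′
  where
  sound′ : ∀ a {j} → (just zero ∷ Maybe.map suc ∘ e) a ≡ just j → g j ≡ true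
  sound′ zero    refl = g₀≡true
  sound′ (suc a) eq   = shifted-sound {g = g} sound a eq
  complete′ : ∀ j → g j ≡ true → ∃ λ a → (just zero ∷ Maybe.map suc ∘ e) a ≡ just j
  complete′ zero    _ = zero , refl
  complete′ (suc j) gj≡true = let a , eq = shifted-complete {g = g} complete j gj≡true in suc a , eq

∣tabulate∣≤⇒enumeration : ∀ {s r} (g : Fin s → Bool) → ∣ tabulate g ∣ ≤ r → ∃ (Enumerates {s} {r} g)
∣tabulate∣≤⇒enumeration {ℕ.zero} g _ = (λ _ → nothing) , (λ _ ()) , (λ ())
∣tabulate∣≤⇒enumeration {ℕ.suc s} g count≤r with g zero in g₀
... | false = Σ.map (Maybe.map suc ∘_) (λ enum → enumerates-skip enum g₀)
                    (∣tabulate∣≤⇒enumeration (g ∘ suc) count≤r)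
∣tabulate∣≤⇒enumeration {ℕ.suc s} {ℕ.zero}  g () | true
∣tabulate∣≤⇒enumeration {ℕ.suc s} {ℕ.suc r} g count≤r | true =
  Σ.map (λ e → just zero ∷ Maybe.map suc ∘ e) (λ enum → enumerates-cons enum g₀)
        (∣tabulate∣≤⇒enumeration (g ∘ suc) (s≤s⁻¹ count≤r))

∃-least : ∀ {m p} {P : Pred (Fin m) p} → Decidable P → ∀ x → P x →
          ∃ λ x₀ → P x₀ × (∀ x′ → x′ < x₀ → ¬ P x′)
∃-least P? zero    px = zero , px , λ _ ()
∃-least {P = P} P? (suc x) px with P? zero
... | yes p₀ = zero , p₀ , λ _ ()
... | no ¬p₀ =
  let x₀ , px₀ , below-x₀ = ∃-least {P = P ∘ suc} (P? ∘ suc) x px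
  in suc x₀ , px₀ , λ { zero _ → ¬p₀ ; (suc x′) x′<x₀ → below-x₀ x′ (s≤s⁻¹ x′<x₀) }

module FirstOccurrence {a} {A : Set a} (_≟_ : DecidableEquality A) {m} (h : Fin m → A) where

  IsFirst : Fin m → Set a
  IsFirst x = ∀ x′ → x′ < x → h x′ ≢ h x

  isFirst? : Decidable IsFirst
  isFirst? x = all? (λ x′ → x′ <? x →-dec ¬? (h x′ ≟ h x))

  isFirst-unique : ∀ {x x′} → IsFirst x → IsFirst x′ → h x ≡ h x′ → x ≡ x′
  isFirst-unique {x} {x′} first first′ eq with <-cmp x x′
  ... | tri< x<x′ _ _ = ⊥-elim (first′ x x<x′ eq)
  ... | tri≈ _ x≡x′ _ = x≡x′
  ... | tri> _ _ x′<x = ⊥-elim (first x′ x′<x (sym eq))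

  first : ∀ x → ∃ λ x₀ → IsFirst x₀ × h x₀ ≡ h x
  first x =
    let x₀ , hx₀≡hx , below-x₀ = ∃-least (λ x′ → h x′ ≟ h x) x refl
    in x₀ , (λ x′ x′<x₀ eq → below-x₀ x′ x′<x₀ (trans eq hx₀≡hx)) , hx₀≡hx

module _ {a} {A : Set a} where

  Apart : ∀ {n} → Vector A n → Vector A n → Set a
  Apart u v = ∀ i → u i ≢ v i

  Apart-sym : ∀ {n} {u v : Vector A n} → Apart u v → Apart v u
  Apart-sym u#v i = u#v i ∘ sym

  Apart-++ : ∀ {m n} {u v : Vector A m} {w z : Vector A n} →
             Apart (u ++ w) (v ++ z) ⇔ (Apart u v × Apart w z)
  Apart-++ {m} {n} {u} {v} {w} {z} = mk⇔
    (λ uw#vz → (λ i → subst₂ _≢_ (lookup-++ˡ u w i) (lookup-++ˡ v z i) (uw#vz (i ↑ˡ n)))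
             , (λ j → subst₂ _≢_ (lookup-++ʳ u w j) (lookup-++ʳ v z j) (uw#vz (m ↑ʳ j))))
    apart
    where
    apart : Apart u v × Apart w z → Apart (u ++ w) (v ++ z)
    apart (u#v , w#z) k with splitAt m k
    ... | inj₁ i = u#v i
    ... | inj₂ j = w#z j

  ¬Apart⇔∃≡ : DecidableEquality A → ∀ {n} {u v : Vector A n} → (¬ Apart u v) ⇔ (∃ λ i → u i ≡ v i)
  ¬Apart⇔∃≡ _≟_ {n} {u} {v} = mk⇔
    (λ ¬u#v → let i , ¬ui≢vi = ¬∀⟶∃¬ n _ (λ i → ¬? (u i ≟ v i)) ¬u#v
              in i , decidable-stable (u i ≟ v i) ¬ui≢vi)
    (λ (i , ui≡vi) u#v → u#v i ui≡vi)

-- Coordinate i colours both sides of F; F is the union over i of the graphs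
-- whose edges join equally coloured vertices, each a disjoint union of bicliques.
UnionOfBiequivalences : BipGraph → ℕ → Set
UnionOfBiequivalences F d =
  ∃ λ (cx : Fin (m F) → Vector ℕ d) → ∃ λ (cy : Fin (n F) → Vector ℕ d) →
    ∀ x y → edge F x y ≡ true ⇔ ∃ λ i → cx x i ≡ cy y i

pragueRep⇒biequivalences : ∀ {H p} → PragueRep H p → UnionOfBiequivalences (bipComplement H) p
pragueRep⇒biequivalences {H} (f , _ , adjacent⇔apart) = f ∘ inj₁ , f ∘ inj₂ , nonEdge⇔agree
  where
  nonEdge⇔agree : ∀ x y → not (edge H x y) ≡ true ⇔ ∃ λ i → f (inj₁ x) i ≡ f (inj₂ y) i
  nonEdge⇔agree x y = mk⇔
    (λ nonEdge → to ¬apart⇔agree (λ apart → to not≡true⇔≢true nonEdge (from xy apart)))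
    (λ agree → from not≡true⇔≢true (λ e → from ¬apart⇔agree agree (to xy e)))
    where
    xy : edge H x y ≡ true ⇔ Apart (f (inj₁ x)) (f (inj₂ y))
    xy = adjacent⇔apart (inj₁ x) (inj₂ y) (λ ())
    ¬apart⇔agree : (¬ Apart (f (inj₁ x)) (f (inj₂ y))) ⇔ (∃ λ i → f (inj₁ x) i ≡ f (inj₂ y) i)
    ¬apart⇔agree = ¬Apart⇔∃≡ ℕ._≟_

module ColourClasses {F : BipGraph} {d} (cx : Fin (m F) → Vector ℕ d) (cy : Fin (n F) → Vector ℕ d)
                     (edge⇔agree : ∀ x y → edge F x y ≡ true ⇔ ∃ λ i → cx x i ≡ cy y i) where

  open FirstOccurrence ℕ._≟_ using (IsFirst; isFirst?; isFirst-unique; first)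

  column : Fin d → Fin (m F) → ℕ
  column i x = cx x i

  -- Each colour class of coordinate i that meets X is named by its first vertex x₀ in X.
  InClass : Vector ℕ d → Fin d × Fin (m F) → Set
  InClass c (i , x₀) = IsFirst (column i) x₀ × c i ≡ cx x₀ i

  inClass? : ∀ c → Decidable (InClass c)
  inClass? c (i , x₀) = isFirst? (column i) x₀ ×-dec (c i ℕ.≟ cx x₀ i)

  inClass-unique : ∀ {c ix ix′} → proj₁ ix ≡ proj₁ ix′ → InClass c ix → InClass c ix′ → ix ≡ ix′
  inClass-unique {ix = i , x₀} {.i , x₀′} refl (x₀-first , c≡) (x₀′-first , c≡′) =
    cong (i ,_) (isFirst-unique (column i) x₀-first x₀′-first (trans (sym c≡) c≡′))

  colourClass : Fin d × Fin (m F) → Biclique F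
  colourClass ix = record
    { left  = tabulate (λ x → does (inClass? (cx x) ix))
    ; right = tabulate (λ y → does (inClass? (cy y) ix))
    ; sub   = λ x y x∈ y∈ →
        let _ , cx≡ = to (∈-tabulate-does⇔ (λ x → inClass? (cx x) ix)) x∈
            _ , cy≡ = to (∈-tabulate-does⇔ (λ y → inClass? (cy y) ix)) y∈
        in from (edge⇔agree x y) (proj₁ ix , trans cx≡ (sym cy≡))
    }

  colourClasses : Fin (d * m F) → Biclique F
  colourClasses = colourClass ∘ remQuot (m F)

  covers : ∀ x y → edge F x y ≡ true → ∃ λ k → x ∈ left (colourClasses k) × y ∈ right (colourClasses k)
  covers x y e =
    let i , cxi≡cyi = to (edge⇔agree x y) e
        x₀ , x₀-first , cx₀≡cx = first (column i) x
    in combine i x₀ ,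
       subst (λ ix → x ∈ left (colourClass ix) × y ∈ right (colourClass ix)) (sym (remQuot-combine i x₀))
         ( from (∈-tabulate-does⇔ (λ x → inClass? (cx x) (i , x₀))) (x₀-first , sym cx₀≡cx)
         , from (∈-tabulate-does⇔ (λ y → inClass? (cy y) (i , x₀)))
                (x₀-first , trans (sym cxi≡cyi) (sym cx₀≡cx)))

  classesContaining≤d : ∀ c → ∣ tabulate (λ k → does (inClass? c (remQuot (m F) k))) ∣ ≤ d
  classesContaining≤d c =
    injection⇒∣tabulate∣≤ _ (λ k _ → proj₁ (remQuot (m F) k)) λ {k} {k′} p q eq →
      remQuot-injective (m F) (inClass-unique {c = c} eq (does≡true⇒ (inClass? c (remQuot (m F) k)) p)
                                                         (does≡true⇒ (inClass? c (remQuot (m F) k′)) q))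

  cover : CanBeCovered F d
  cover = d * m F , colourClasses , covers , countLeft , countRight
    where
    countLeft : ∀ x → ∣ tabulate (λ k → lookup (left (colourClasses k)) x) ∣ ≤ d
    countLeft x = subst (_≤ d)
      (sym (∣tabulate-lookup-tabulate∣ (λ k x → does (inClass? (cx x) (remQuot (m F) k))) x))
      (classesContaining≤d (cx x))
    countRight : ∀ y → ∣ tabulate (λ k → lookup (right (colourClasses k)) y) ∣ ≤ d
    countRight y = subst (_≤ d)
      (sym (∣tabulate-lookup-tabulate∣ (λ k y → does (inClass? (cy y) (remQuot (m F) k))) y))
      (classesContaining≤d (cy y))

biequivalences⇒cover : ∀ {F d} → UnionOfBiequivalences F d → CanBeCovered F d
biequivalences⇒cover (cx , cy , edge⇔agree) = ColourClasses.cover cx cy edge⇔agree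

-- An empty slot is labelled 0 on the X side and 1 on the Y side, so that two
-- labels agree only when both slots hold the same biclique j, labelled j + 2.
slotLabel : ∀ {s} → ℕ → Maybe (Fin s) → ℕ
slotLabel _     (just j) = 2 + toℕ j
slotLabel empty nothing  = empty

slotLabel-agree : ∀ {s} {u v : Maybe (Fin s)} →
                  slotLabel 0 u ≡ slotLabel 1 v → ∃ λ j → u ≡ just j × v ≡ just j
slotLabel-agree {u = just j} {just j′} eq = j , refl , cong just (toℕ-injective (ℕ.+-cancelˡ-≡ 2 _ _ (sym eq)))
slotLabel-agree {u = just _} {nothing} ()
slotLabel-agree {u = nothing} {just _} ()
slotLabel-agree {u = nothing} {nothing} ()

module CoverSlots {F : BipGraph} {r s} (B : Fin s → Biclique F) (cov : RCovers F r s B) where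

  bicliquesAt-left : (x : Fin (m F)) → ∃ (Enumerates (λ i → lookup (left (B i)) x))
  bicliquesAt-left x = ∣tabulate∣≤⇒enumeration _ (proj₁ (proj₂ cov) x)

  bicliquesAt-right : (y : Fin (n F)) → ∃ (Enumerates (λ i → lookup (right (B i)) y))
  bicliquesAt-right y = ∣tabulate∣≤⇒enumeration _ (proj₂ (proj₂ cov) y)

  slotPair : Fin (r * r) → Fin r × Fin r
  slotPair = remQuot {r} r

  cx : Fin (m F) → Vector ℕ (r * r)
  cx x k = slotLabel 0 (proj₁ (bicliquesAt-left x) (proj₁ (slotPair k)))

  cy : Fin (n F) → Vector ℕ (r * r)
  cy y k = slotLabel 1 (proj₁ (bicliquesAt-right y) (proj₂ (slotPair k)))

  edge⇔agree : ∀ x y → edge F x y ≡ true ⇔ ∃ λ k → cx x k ≡ cy y k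
  edge⇔agree x y = mk⇔ agree isEdge
    where
    ex : ∃ (Enumerates (λ i → lookup (left (B i)) x))
    ex = bicliquesAt-left x
    ey : ∃ (Enumerates (λ i → lookup (right (B i)) y))
    ey = bicliquesAt-right y

    agree : edge F x y ≡ true → ∃ λ k → cx x k ≡ cy y k
    agree e =
      let j , x∈ , y∈ = proj₁ cov x y e
          a , a↦j = proj₂ (proj₂ ex) j ([]=⇒lookup x∈)
          b , b↦j = proj₂ (proj₂ ey) j ([]=⇒lookup y∈)
      in combine a b ,
         subst (λ ab → slotLabel 0 (proj₁ ex (proj₁ ab)) ≡ slotLabel 1 (proj₁ ey (proj₂ ab)))
               (sym (remQuot-combine a b))
               (trans (cong (slotLabel 0) a↦j) (cong (slotLabel 1) (sym b↦j)))

    isEdge : (∃ λ k → cx x k ≡ cy y k) → edge F x y ≡ true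
    isEdge (k , agree) =
      let a , b = slotPair k
          j , a↦j , b↦j = slotLabel-agree agree
      in sub (B j) x y (lookup⇒[]= x _ (proj₁ (proj₂ ex) a a↦j)) (lookup⇒[]= y _ (proj₁ (proj₂ ey) b b↦j))

cover⇒biequivalences : ∀ {F r} → CanBeCovered F r → UnionOfBiequivalences F (r * r)
cover⇒biequivalences (s , B , cov) = cx , cy , edge⇔agree
  where open CoverSlots B cov

module TaggedColours {H : BipGraph} {d} (cx : Fin (m H) → Vector ℕ d) (cy : Fin (n H) → Vector ℕ d)
                     (nonEdge⇔agree : ∀ x y → not (edge H x y) ≡ true ⇔ ∃ λ i → cx x i ≡ cy y i) where

  colours : Vertex H → Vector ℕ d
  colours (inj₁ x) = cx x
  colours (inj₂ y) = cy y

  -- The first tag is constant on X and injective on Y, the second the other way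
  -- round: together they separate all vertices, never let X meet Y, and make
  -- any two vertices of the same side agree somewhere.
  tag : Vertex H → Vector ℕ 2
  tag (inj₁ x) = 0 ∷ 1 + toℕ x ∷ []
  tag (inj₂ y) = 1 + toℕ y ∷ 0 ∷ []

  code : Vertex H → Vector ℕ (d + 2)
  code u = colours u ++ tag u

  tag-injective : ∀ u v → tag u ≗ tag v → u ≡ v
  tag-injective (inj₁ x) (inj₁ x′) eq = cong inj₁ (toℕ-injective (ℕ.suc-injective (eq (suc zero))))
  tag-injective (inj₂ y) (inj₂ y′) eq = cong inj₂ (toℕ-injective (ℕ.suc-injective (eq zero)))
  tag-injective (inj₁ x) (inj₂ y)  eq with () ← eq zero
  tag-injective (inj₂ y) (inj₁ x)  eq with () ← eq zero

  code-injective : Injective _≡_ _≡_ code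
  code-injective {u} {v} eq = tag-injective u v (++-injectiveʳ (colours u) (colours v) (cong-app eq))

  edge⇔apart : ∀ x y → edge H x y ≡ true ⇔ Apart (code (inj₁ x)) (code (inj₂ y))
  edge⇔apart x y = mk⇔ apart isEdge
    where
    apart : edge H x y ≡ true → Apart (code (inj₁ x)) (code (inj₂ y))
    apart e = from Apart-++
      ( (λ i cx≡cy → to not≡true⇔≢true (from (nonEdge⇔agree x y) (i , cx≡cy)) e)
      , λ { zero () ; (suc zero) () } )

    isEdge : Apart (code (inj₁ x)) (code (inj₂ y)) → edge H x y ≡ true
    isEdge x#y with edge H x y | nonEdge⇔agree x y
    ... | true  | _  = refl
    ... | false | xy = ⊥-elim (from (¬Apart⇔∃≡ ℕ._≟_) (to xy refl) (proj₁ (to Apart-++ x#y)))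

  adjacent⇔apart : ∀ u v → u ≢ v → Adj H u v ⇔ Apart (code u) (code v)
  adjacent⇔apart (inj₁ x) (inj₂ y)  _ = edge⇔apart x y
  adjacent⇔apart (inj₂ y) (inj₁ x)  _ =
    mk⇔ (Apart-sym ∘ to (edge⇔apart x y)) (from (edge⇔apart x y) ∘ Apart-sym)
  adjacent⇔apart (inj₁ x) (inj₁ x′) _ = mk⇔ (λ ()) (λ x#x′ → proj₂ (to Apart-++ x#x′) zero refl)
  adjacent⇔apart (inj₂ y) (inj₂ y′) _ = mk⇔ (λ ()) (λ y#y′ → proj₂ (to Apart-++ y#y′) (suc zero) refl)

  pragueRep : PragueRep H (d + 2)
  pragueRep = code , code-injective , adjacent⇔apart

biequivalences⇒pragueRep : ∀ {H d} → UnionOfBiequivalences (bipComplement H) d → PragueRep H (d + 2)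
biequivalences⇒pragueRep (cx , cy , nonEdge⇔agree) = TaggedColours.pragueRep cx cy nonEdge⇔agree

theorem45 : (H : BipGraph) →
    (∀ d → IsPragueDim H d → CanBeCovered (bipComplement H) d) ×
    (∀ r → CanBeCovered (bipComplement H) r → ∀ d → IsPragueDim H d → d ≤ r * r + 2)
theorem45 H =
  (λ d (rep , _) → biequivalences⇒cover (pragueRep⇒biequivalences rep)) ,
  (λ r cover d (_ , minimal) → minimal (r * r + 2) (biequivalences⇒pragueRep (cover⇒biequivalences cover)))
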